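{- Let $G$ be a thin graph and $x\in\mathbb{B}(G)$, and let $P^1$ and $P^2$ be arbitrary partial product colorings of the induced neighborhood $\langle N[x]\rangle$. Then $P^2$ is a color-continuation of $P^1$, and $P^1$ is a color-continuation of $P^2$.
   Context: All graphs are finite, simple, connected, undirected. $N[v]$ is the closed neighborhood in $G$, and $\langle W\rangle$ is the induced subgraph on $W$. $G$ is thin if no two distinct vertices have equal closed neighborhoods. For an induced subgraph $H$ and $u\in V(H)$, $S_H(u)=\{v\in V(H):N[v]\cap V(H)=N[u]\cap V(H)\}$, and $S_y(u):=S_{\langle N[y]\rangle}(u)$. The backbone is $\mathbb{B}(G)=\{v:|S_v(v)|=1\}$. An edge $(a,b)$ satisfies the S1-condition in $H$ if $a,b\in V(H)$ and $|S_H(a)|=1$ or $|S_H(b)|=1$. Strong product: vertex set the Cartesian product of vertex sets; distinct vertices are adjacent iff in each coordinate they are equal or adjacent. Cartesian edges differ in exactly one coordinate. A partial product coloring of an induced subgraph $H$ with a representation $H=\boxtimes_{i=1}^kK_i$ ($k\ge1$, factors not necessarily prime) is the map, on the Cartesian edges of $H$ satisfying the S1-condition in $H$, assigning color $i$ to edges lying in $K_i$-fibers. For subgraphs $H_1,H_2$ with partial product colorings $P_{H_1},P_{H_2}$: $P_{H_2}$ is a color-continuation of $P_{H_1}$ if for every color $c$ in the image of $P_{H_2}$ there is an edge of $H_2$ with $P_{H_2}$-color $c$ that also lies in the domain of $P_{H_1}$. -}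

module Defs where

open import Data.Nat using (ℕ; _≤_)
open import Data.Fin using (Fin)
open import Data.Bool using (Bool; true; false; T)
open import Data.Product using (Σ; ∃; ∃-syntax; _×_; _,_)
open import Data.Sum using (_⊎_)
open import Relation.Nullary using (¬_)
open import Relation.Binary.PropositionalEquality using (_≡_; _≢_)
open import Function.Bundles using (_⇔_)

data Walk {n : ℕ} (adj : Fin n → Fin n → Bool) : Fin n → Fin n → Set where
  here : ∀ {u} → Walk adj u u
  step : ∀ {u v w} → T (adj u v) → Walk adj v w → Walk adj u w

record Graph : Set where
  field
    n         : ℕ
    adj       : Fin n → Fin n → Bool
    sym       : ∀ u v → adj u v ≡ adj v u
    irrefl    : ∀ u → adj u u ≡ false
    connected : ∀ u v → Walk adj u v

  V : Set
  V = Fin n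

  Adj : V → V → Set
  Adj u v = T (adj u v)

  _∈N[_] : V → V → Set
  u ∈N[ v ] = u ≡ v ⊎ Adj u v

open Graph public

Thin : Graph → Set
Thin G = ∀ u v → (∀ w → (_∈N[_] G w u) ⇔ (_∈N[_] G w v)) → u ≡ v

IsSingleton : {A : Set} → (A → Set) → Set
IsSingleton {A} S = Σ A λ a → S a × (∀ b → S b → b ≡ a)

-- The induced neighbourhood H = ⟨N[x]⟩ ; its vertices are the u with
-- u ∈N[ x ], its edges are the edges of G between such vertices.

-- S_x(u) = S_{⟨N[x]⟩}(u) = { v ∈ V(H) : N[v] ∩ V(H) = N[u] ∩ V(H) }
Sx : (G : Graph) → V G → V G → V G → Set
Sx G x u v = _∈N[_] G v x ×
  (∀ w → _∈N[_] G w x → (_∈N[_] G w v) ⇔ (_∈N[_] G w u))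

InBackbone : (G : Graph) → V G → Set
InBackbone G v = IsSingleton (Sx G v v)

S1 : (G : Graph) → V G → V G → V G → Set
S1 G x a b = _∈N[_] G a x × _∈N[_] G b x ×
  (IsSingleton (Sx G x a) ⊎ IsSingleton (Sx G x b))

ProdV : {k : ℕ} → (Fin k → Graph) → Set
ProdV {k} K = (i : Fin k) → V (K i)

_≈P_ : {k : ℕ} {K : Fin k → Graph} → ProdV K → ProdV K → Set
s ≈P t = ∀ i → s i ≡ t i

StrongAdj : {k : ℕ} (K : Fin k → Graph) → ProdV K → ProdV K → Set
StrongAdj K s t = ¬ (_≈P_ {K = K} s t) × (∀ i → s i ≡ t i ⊎ Adj (K i) (s i) (t i))

-- A representation  ⟨N[x]⟩ ≅ ⊠_{i=1}^k K_i  (k ≥ 1, factors not necessarily prime).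
-- φ is a map on V(G); only its restriction to V(⟨N[x]⟩) = N[x] matters.
record ProductRep (G : Graph) (x : V G) : Set₁ where
  field
    k     : ℕ
    k≥1   : 1 ≤ k
    K     : Fin k → Graph
    φ     : V G → ProdV K
    inj   : ∀ a b → _∈N[_] G a x → _∈N[_] G b x →
              _≈P_ {K = K} (φ a) (φ b) → a ≡ b
    surj  : ∀ (t : ProdV K) → Σ (V G) λ a → _∈N[_] G a x × _≈P_ {K = K} (φ a) t
    hom   : ∀ a b → _∈N[_] G a x → _∈N[_] G b x →
              Adj G a b ⇔ StrongAdj K (φ a) (φ b)

open ProductRep public

-- the partial product coloring P_R of ⟨N[x]⟩ w.r.t. representation R:
-- "PColor R a b i" says the edge (a , b) is in the domain of P_R
-- (a Cartesian edge of ⟨N[x]⟩ satisfying the S1-condition) and has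
-- color i, i.e. it lies in a K_i-fiber (differs exactly in coordinate i).
PColor : (G : Graph) (x : V G) (R : ProductRep G x) → V G → V G → Fin (k R) → Set
PColor G x R a b i =
  Adj G a b × S1 G x a b ×
  (φ R a i ≢ φ R b i) × (∀ j → j ≢ i → φ R a j ≡ φ R b j)

InDomain : (G : Graph) (x : V G) (R : ProductRep G x) → V G → V G → Set
InDomain G x R a b = ∃[ i ] PColor G x R a b i

ColorContinuation : (G : Graph) (x : V G) (R₂ R₁ : ProductRep G x) → Set
ColorContinuation G x R₂ R₁ =
  ∀ (c : Fin (k R₂)) →
    (∃[ a ] ∃[ b ] PColor G x R₂ a b c) →
    ∃[ a ] ∃[ b ] (PColor G x R₂ a b c × InDomain G x R₁ a b)

-- Write H = ⟨N[x]⟩ ≅ ⊠ Kᵢ. Since x dominates H, every coordinate of x dominates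
-- its factor; conversely a dominating t in Kᵢ yields, by replacing the i-th
-- coordinate of x with t, a dominating vertex of H, which lies in S_x(x) and so
-- equals x because x is in the backbone. Thus x is the unique dominating vertex
-- of H and its coordinates are the unique dominating vertices of the factors.
-- Given a color c of one coloring, move x in coordinate c to get some v ≠ x.
-- In the other representation v differs from x in a coordinate j; moving x in
-- coordinate j only, to the j-th coordinate of v, gives w with N[v] ⊆ N[w].
-- Every coordinate ≠ c of v dominates, hence so does the one of w, hence it
-- equals that of x: the edge xw is Cartesian of color c in the first
-- representation and of color j in the second, and it satisfies the
-- S1-condition because |S_x(x)| = 1.
module Submission where

open import Defs
open import Data.Product using (_×_; _,_; proj₁; proj₂; Σ; ∃-syntax)
open import Data.Sum using (inj₁; inj₂)
open import Data.Fin using (Fin; _≟_)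
open import Data.Fin.Properties using (¬∀⟶∃¬)
open import Data.Bool using (T)
open import Data.Nat using (ℕ)
open import Data.Empty using (⊥-elim)
open import Relation.Nullary using (Dec; yes; no)
open import Relation.Binary.PropositionalEquality
  using (_≡_; _≢_; refl; subst; cong; trans) renaming (sym to ≡-sym)
open import Function.Bundles using (mk⇔; Equivalence)

Dominating : (K : Graph) → V K → Set
Dominating K t = ∀ s → _∈N[_] K s t

StrongClosed : {k : ℕ} (K : Fin k → Graph) → ProdV K → ProdV K → Set
StrongClosed K s t = ∀ i → _∈N[_] (K i) (s i) (t i)

update : {k : ℕ} {K : Fin k → Graph} → ProdV K → (i : Fin k) → V (K i) → ProdV K
update s i a l with i ≟ l
... | yes refl = a
... | no _ = s l

update-same : {k : ℕ} {K : Fin k → Graph} (s : ProdV K) (i : Fin k) (a : V (K i)) →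
  update {K = K} s i a i ≡ a
update-same s i a with i ≟ i
... | yes refl = refl
... | no i≢i = ⊥-elim (i≢i refl)

update-other : {k : ℕ} {K : Fin k → Graph} (s : ProdV K) (i : Fin k) (a : V (K i)) →
  ∀ l → i ≢ l → update {K = K} s i a l ≡ s l
update-other s i a l i≢l with i ≟ l
... | yes refl = ⊥-elim (i≢l refl)
... | no _ = refl

module _ (G : Graph) (x : V G) where

  open Graph G using () renaming (_∈N[_] to _∈N⟨_⟩)

  _∈H : V G → Set
  a ∈H = a ∈N⟨ x ⟩

  _⊆H_ : V G → V G → Set
  v ⊆H w = ∀ z → z ∈H → z ∈N⟨ v ⟩ → z ∈N⟨ w ⟩

  DominatesH : V G → Set
  DominatesH w = ∀ z → z ∈H → z ∈N⟨ w ⟩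

  Cartesian : (R : ProductRep G x) → V G → V G → Fin (k R) → Set
  Cartesian R a b i = φ R a i ≢ φ R b i × (∀ j → j ≢ i → φ R a j ≡ φ R b j)

  dominatesH⇒≡x : InBackbone G x → ∀ w → w ∈H → DominatesH w → w ≡ x
  dominatesH⇒≡x (_ , _ , unique) w w∈H dom = trans (unique w w∈S) (≡-sym (unique x x∈S))
    where
      x∈S : Sx G x x x
      x∈S = inj₁ refl , λ _ _ → mk⇔ (λ p → p) (λ p → p)
      w∈S : Sx G x x w
      w∈S = w∈H , λ z z∈H → mk⇔ (λ _ → z∈H) (λ _ → dom z z∈H)

  cartesian⇒≢ : (R : ProductRep G x) → ∀ {a b i} → Cartesian R a b i → b ≢ a
  cartesian⇒≢ R {i = i} (differ , _) b≡a = differ (cong (λ q → φ R q i) (≡-sym b≡a))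

  colored-at-x : InBackbone G x → (R : ProductRep G x) → ∀ w i → w ∈H →
    Cartesian R x w i → PColor G x R x w i
  colored-at-x bb R w i w∈H cart = x~w w∈H , (inj₁ refl , w∈H , inj₁ bb) , cart
    where
      x~w : w ∈H → Adj G x w
      x~w (inj₁ w≡x) = ⊥-elim (cartesian⇒≢ R cart w≡x)
      x~w (inj₂ w~x) = subst T (Graph.sym G w x) w~x

  module Representation (R : ProductRep G x) where

    _[_≔_] : ProdV (K R) → (i : Fin (k R)) → V (K R i) → ProdV (K R)
    _[_≔_] = update {K = K R}

    vertexAt : ProdV (K R) → V G
    vertexAt t = proj₁ (surj R t)

    vertexAt-∈H : ∀ t → vertexAt t ∈H
    vertexAt-∈H t = proj₁ (proj₂ (surj R t))

    φ-vertexAt : ∀ t l → φ R (vertexAt t) l ≡ t l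
    φ-vertexAt t l = proj₂ (proj₂ (surj R t)) l

    φ-update-same : ∀ s i a → φ R (vertexAt (s [ i ≔ a ])) i ≡ a
    φ-update-same s i a = trans (φ-vertexAt _ i) (update-same {K = K R} s i a)

    φ-update-other : ∀ s i a l → i ≢ l → φ R (vertexAt (s [ i ≔ a ])) l ≡ s l
    φ-update-other s i a l i≢l = trans (φ-vertexAt _ l) (update-other {K = K R} s i a l i≢l)

    closed⇒strongClosed : ∀ a b → a ∈H → b ∈H → a ∈N⟨ b ⟩ → StrongClosed (K R) (φ R a) (φ R b)
    closed⇒strongClosed a b a∈H b∈H (inj₁ refl) i = inj₁ refl
    closed⇒strongClosed a b a∈H b∈H (inj₂ a~b) = proj₂ (Equivalence.to (hom R a b a∈H b∈H) a~b)

    strongClosed⇒closed : ∀ a b → a ∈H → b ∈H → StrongClosed (K R) (φ R a) (φ R b) → a ∈N⟨ b ⟩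
    strongClosed⇒closed a b a∈H b∈H closed with a ≟ b
    ... | yes a≡b = inj₁ a≡b
    ... | no a≢b = inj₂ (Equivalence.from (hom R a b a∈H b∈H)
                          ((λ φa≈φb → a≢b (inj R a b a∈H b∈H φa≈φb)) , closed))

    φx-dominating : ∀ i → Dominating (K R i) (φ R x i)
    φx-dominating i s = subst (λ q → _∈N[_] (K R i) q (φ R x i)) (φ-update-same (φ R x) i s)
      (closed⇒strongClosed z x (vertexAt-∈H _) (inj₁ refl) (vertexAt-∈H _) i)
      where
        z = vertexAt (φ R x [ i ≔ s ])

    dominating-coords⇒dominatesH : ∀ w → w ∈H → (∀ l → Dominating (K R l) (φ R w l)) → DominatesH w
    dominating-coords⇒dominatesH w w∈H dom z z∈H =
      strongClosed⇒closed z w z∈H w∈H λ l → dom l (φ R z l)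

    -- Test against the vertex z obtained from v by moving its i-th coordinate to s:
    -- z ∈ N[v] because φ v i dominates, hence z ∈ N[w].
    dominating-coord-mono : ∀ v w i → v ∈H → w ∈H → v ⊆H w →
      Dominating (K R i) (φ R v i) → Dominating (K R i) (φ R w i)
    dominating-coord-mono v w i v∈H w∈H v⊆w dom s =
      subst (λ q → _∈N[_] (K R i) q (φ R w i)) (φ-update-same (φ R v) i s)
        (closed⇒strongClosed z w z∈H w∈H (v⊆w z z∈H z~v) i)
      where
        z = vertexAt (φ R v [ i ≔ s ])
        z∈H = vertexAt-∈H _
        z~v : z ∈N⟨ v ⟩
        z~v = strongClosed⇒closed z v z∈H v∈H λ l → coord l (i ≟ l)
          where
            coord : ∀ l → Dec (i ≡ l) → _∈N[_] (K R l) (φ R z l) (φ R v l)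
            coord l (yes refl) = dom (φ R z i)
            coord l (no i≢l) = inj₁ (φ-update-other (φ R v) i s l i≢l)

    dominating-coord-unique : InBackbone G x → ∀ i t → Dominating (K R i) t → t ≡ φ R x i
    dominating-coord-unique bb i t dom =
      trans (≡-sym (φ-update-same (φ R x) i t)) (cong (λ q → φ R q i) y≡x)
      where
        y = vertexAt (φ R x [ i ≔ t ])
        y-dominating : ∀ l → Dominating (K R l) (φ R y l)
        y-dominating l with i ≟ l
        ... | yes refl = subst (Dominating (K R i)) (≡-sym (φ-update-same (φ R x) i t)) dom
        ... | no i≢l = subst (Dominating (K R l)) (≡-sym (φ-update-other (φ R x) i t l i≢l))
                          (φx-dominating l)
        y≡x : y ≡ x
        y≡x = dominatesH⇒≡x bb y (vertexAt-∈H _)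
                (dominating-coords⇒dominatesH y (vertexAt-∈H _) y-dominating)

    -- w is x moved, in a coordinate j where v and x differ, to the j-th coordinate of v;
    -- the other coordinates of w are those of x and dominate.
    cartesian-cover : ∀ v → v ∈H → v ≢ x →
      ∃[ j ] ∃[ w ] (w ∈H × Cartesian R x w j × v ⊆H w)
    cartesian-cover v v∈H v≢x = j , w , vertexAt-∈H _ , cartesian , v⊆w
      where
        differing : Σ (Fin (k R)) λ j → φ R v j ≢ φ R x j
        differing = ¬∀⟶∃¬ (k R) (λ l → φ R v l ≡ φ R x l) (λ l → φ R v l ≟ φ R x l)
                      (λ φv≈φx → v≢x (inj R v x v∈H (inj₁ refl) φv≈φx))
        j = proj₁ differing
        w = vertexAt (φ R x [ j ≔ φ R v j ])
        cartesian : Cartesian R x w j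
        cartesian = (λ φxj≡φwj → proj₂ differing
                        (≡-sym (trans φxj≡φwj (φ-update-same (φ R x) j (φ R v j)))))
                  , λ l l≢j → ≡-sym (φ-update-other (φ R x) j (φ R v j) l (λ j≡l → l≢j (≡-sym j≡l)))
        v⊆w : v ⊆H w
        v⊆w z z∈H z~v = strongClosed⇒closed z w z∈H (vertexAt-∈H _) λ l → coord l (j ≟ l)
          where
            coord : ∀ l → Dec (j ≡ l) → _∈N[_] (K R l) (φ R z l) (φ R w l)
            coord l (yes refl) = subst (_∈N[_] (K R j) (φ R z j))
              (≡-sym (φ-update-same (φ R x) j (φ R v j))) (closed⇒strongClosed z v z∈H v∈H z~v j)
            coord l (no j≢l) = subst (_∈N[_] (K R l) (φ R z l))
              (≡-sym (φ-update-other (φ R x) j (φ R v j) l j≢l)) (φx-dominating l (φ R z l))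

    cartesian-neighbour : ∀ c a b → φ R a c ≢ φ R b c → ∃[ v ] (v ∈H × Cartesian R x v c)
    cartesian-neighbour c a b φac≢φbc = v , vertexAt-∈H _ , differ , agree
      where
        off-x : Σ (V (K R c)) λ s → s ≢ φ R x c
        off-x with φ R a c ≟ φ R x c
        ... | yes φac≡φxc = φ R b c , λ φbc≡φxc → φac≢φbc (trans φac≡φxc (≡-sym φbc≡φxc))
        ... | no φac≢φxc = φ R a c , φac≢φxc
        s = proj₁ off-x
        v = vertexAt (φ R x [ c ≔ s ])
        differ : φ R x c ≢ φ R v c
        differ φxc≡φvc = proj₂ off-x (≡-sym (trans φxc≡φvc (φ-update-same (φ R x) c s)))
        agree : ∀ i → i ≢ c → φ R x i ≡ φ R v i
        agree i i≢c = ≡-sym (φ-update-other (φ R x) c s i (λ c≡i → i≢c (≡-sym c≡i)))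

    cartesian-transfer : InBackbone G x → ∀ v w c → v ∈H → w ∈H → w ≢ x →
      Cartesian R x v c → v ⊆H w → Cartesian R x w c
    cartesian-transfer bb v w c v∈H w∈H w≢x (_ , x≈v-off-c) v⊆w = differ , agree
      where
        agree : ∀ i → i ≢ c → φ R x i ≡ φ R w i
        agree i i≢c = ≡-sym (dominating-coord-unique bb i (φ R w i)
          (dominating-coord-mono v w i v∈H w∈H v⊆w
            (subst (Dominating (K R i)) (x≈v-off-c i i≢c) (φx-dominating i))))
        differ : φ R x c ≢ φ R w c
        differ φxc≡φwc = w≢x (≡-sym (inj R x w (inj₁ refl) w∈H all))
          where
            all : _≈P_ {K = K R} (φ R x) (φ R w)
            all i with i ≟ c
            ... | yes refl = φxc≡φwc
            ... | no i≢c = agree i i≢c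

  color-continuation : InBackbone G x → (A B : ProductRep G x) → ColorContinuation G x A B
  color-continuation bb A B c (a , b , _ , _ , φac≢φbc , _) =
    shared-edge (A.cartesian-neighbour c a b φac≢φbc)
    where
      module A = Representation A
      module B = Representation B
      shared-edge : ∃[ v ] (v ∈H × Cartesian A x v c) →
        ∃[ a ] ∃[ b ] (PColor G x A a b c × InDomain G x B a b)
      shared-edge (v , v∈H , cartAv) with B.cartesian-cover v v∈H (cartesian⇒≢ A cartAv)
      ... | j , w , w∈H , cartB , v⊆w =
        x , w , colored-at-x bb A w c w∈H cartA , j , colored-at-x bb B w j w∈H cartB
        where
          cartA : Cartesian A x w c
          cartA = A.cartesian-transfer bb v w c v∈H w∈H (cartesian⇒≢ B cartB) cartAv v⊆w

lemma3p36 : (G : Graph) → Thin G → (x : V G) → InBackbone G x →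
    (P¹ P² : ProductRep G x) →
    ColorContinuation G x P² P¹ × ColorContinuation G x P¹ P²
lemma3p36 G _ x bb P¹ P² = color-continuation G x bb P² P¹ , color-continuation G x bb P¹ P²
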